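{- Let $n\ge 2$, let $d$ be an integer with $1\le d\le \frac{n}{2}$, and let $j_1\neq j_2$ be elements of $\{1,\dots,n\}$. Then the characteristic polynomial of $A=C_n+T(1,j_1,d+1,j_2)$ is $$p(x)=x^n-x^{n-j_1}+x^{[n-j_1+d]}+x^{n-j_2}-x^{[n-j_2+d]}-1,$$ where for an integer $t$, $[t]$ denotes the remainder on dividing $t$ by $n$.
   Context: $C_n$ is the companion matrix of $x^n-1$: the $n\times n$ matrix with $1$ in positions $(i+1,i)$ for $1\le i\le n-1$, $1$ in position $(1,n)$, and $0$ elsewhere. $T(i_1,j_1,i_2,j_2)$ (with $i_1\ne i_2$, $j_1\ne j_2$) is the $n\times n$ matrix with $1$ in positions $(i_1,j_1),(i_2,j_2)$, $-1$ in positions $(i_1,j_2),(i_2,j_1)$, and $0$ elsewhere. -}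

module Defs where

open import Data.Bool using (Bool; true; false; _∧_; _∨_; if_then_else_)
open import Data.Nat as ℕ using (ℕ; zero; suc; _∸_; _≡ᵇ_)
open import Data.Nat.DivMod using (_%_)
open import Data.Integer as ℤ using (ℤ; +_; -_; _+_; _*_; _-_)
open import Data.Fin using (Fin; toℕ; punchIn) renaming (zero to fzero; suc to fsuc)
open import Data.List using (List; map; foldr; upTo)

-- Univariate polynomials over ℤ, represented by their coefficient sequence
-- (coefficient of x^k at index k); all polynomials below have finite support.
Poly : Set
Poly = ℕ → ℤ

sumℤ : List ℤ → ℤ
sumℤ = foldr _+_ (+ 0)

_⊕_ : Poly → Poly → Poly
(p ⊕ q) k = p k + q k

⊝_ : Poly → Poly
(⊝ p) k = - p k

_⊛_ : Poly → Poly → Poly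
(p ⊛ q) k = sumℤ (map (λ i → p i * q (k ∸ i)) (upTo (suc k)))

constP : ℤ → Poly
constP c zero    = c
constP c (suc _) = + 0

monoP : ℤ → ℕ → Poly
monoP c m k with m ≡ᵇ k
... | true  = c
... | false = + 0

X : Poly
X = monoP (+ 1) 1

sign : ℕ → ℤ
sign zero    = + 1
sign (suc k) = - sign k

sumF : ∀ {m} → (Fin m → Poly) → Poly
sumF {zero}  f k = + 0
sumF {suc m} f k = f fzero k + sumF (λ i → f (fsuc i)) k

det : ∀ {m} → (Fin m → Fin m → Poly) → Poly
det {zero}  M = constP (+ 1)
det {suc m} M = sumF λ j →
  constP (sign (toℕ j)) ⊛ (M fzero j ⊛ det (λ r c → M (fsuc r) (punchIn j c)))

charPoly : ∀ {m} → (Fin m → Fin m → ℤ) → Poly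
charPoly A = det λ i j → (if (toℕ i ≡ᵇ toℕ j) then X else constP (+ 0)) ⊕ constP (- A i j)

ind : Bool → ℤ
ind true  = + 1
ind false = + 0

-- Companion matrix C_n of x^n − 1 (paper uses 1-based indices; Fin n index r is row r+1):
-- 1 at (i+1, i) for 1 ≤ i ≤ n−1, and 1 at (1, n).
C : (n : ℕ) → Fin n → Fin n → ℤ
C n r c = ind ((toℕ r ≡ᵇ suc (toℕ c)) ∨ ((toℕ r ≡ᵇ 0) ∧ (suc (toℕ c) ≡ᵇ n)))

-- T(i₁,j₁,i₂,j₂) with 1-based parameters: +1 at (i₁,j₁),(i₂,j₂); −1 at (i₁,j₂),(i₂,j₁).
T : (n i₁ j₁ i₂ j₂ : ℕ) → Fin n → Fin n → ℤ
T n i₁ j₁ i₂ j₂ r c =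
  let at : ℕ → ℕ → Bool
      at a b = (suc (toℕ r) ≡ᵇ a) ∧ (suc (toℕ c) ≡ᵇ b)
  in (ind (at i₁ j₁) + ind (at i₂ j₂)) - (ind (at i₁ j₂) + ind (at i₂ j₁))

_⊞_ : ∀ {n} → (Fin n → Fin n → ℤ) → (Fin n → Fin n → ℤ) → Fin n → Fin n → ℤ
(A ⊞ B) r c = A r c + B r c

rem : (n t : ℕ) → .{{ℕ.NonZero n}} → ℕ
rem n t = t % n

-- Only rows 1 and d + 1 of x·I − A differ from those of x·I − C_n: row 1 is
-- x·e₁ − e_n − e_{j₁} + e_{j₂} and row d + 1 is (x·e_{d+1} − e_d) + e_{j₁} − e_{j₂}.  The determinant
-- is linear in each of these rows, so det(x·I − A) is a sum of twelve determinants whose two special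
-- rows are multiples of unit vectors.  Deleting those rows and the columns of their nonzero entries
-- leaves x·I − C_n without two rows and two columns, which is block triangular with bidiagonal
-- diagonal blocks; hence every term is 0 or ± a power of x.  Row 1 against the unperturbed row d + 1
-- gives x^n, −1, −x^{n−j₁} and x^{n−j₂}; the part x·e₁ − e_n of row 1 against ±e_j gives ±x^{[n−j+d]}
-- (from x·e₁ when j > d, from −e_n when j ≤ d); the two terms with both unit vectors in one column
-- vanish, and the two mixed terms cancel since they differ by a transposition of two columns.

module Submission where

open import Defs
open import Data.Bool using (Bool; true; false; if_then_else_; _∧_; _∨_)
open import Data.Bool.Properties using (∨-identityʳ)
open import Data.Nat using (ℕ; zero; suc; _≤_; _<_; _+_; _*_; _∸_; _≡ᵇ_; _<ᵇ_; z≤n; s≤s; NonZero)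
open import Data.Nat.DivMod using (_%_; [m+n]%n≡m%n; m<n⇒m%n≡m)
import Data.Nat.Properties as ℕ
import Data.Nat.Tactic.RingSolver as ℕ-Solver
open import Data.Integer using (ℤ; +_; -_) renaming (_+_ to _+ᶻ_; _*_ to _*ᶻ_; _-_ to _-ᶻ_)
import Data.Integer.Properties as ℤ
open import Data.Integer.Tactic.RingSolver using (solve-∀)
open import Data.List using (List; []; _∷_; map; applyUpTo; upTo)
open import Data.Fin using (Fin; toℕ; punchIn) renaming (zero to fzero; suc to fsuc)
import Data.Fin.Properties as Fin
open import Data.Product using (_,_)
open import Function using (_∘_; id)
open import Level using (0ℓ)
open import Data.Empty using (⊥-elim)
open import Relation.Nullary using (yes; no)
open import Relation.Binary using (Setoid)
import Relation.Binary.Reasoning.Setoid as SetoidReasoning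
open import Relation.Binary.PropositionalEquality using (_≡_; _≢_; refl; sym; trans; cong; cong₂; subst)

infix 4 _≈_
_≈_ : Poly → Poly → Set
p ≈ q = ∀ k → p k ≡ q k

≈-refl : ∀ {p} → p ≈ p
≈-refl _ = refl

≈-sym : ∀ {p q} → p ≈ q → q ≈ p
≈-sym e k = sym (e k)

≈-trans : ∀ {p q r} → p ≈ q → q ≈ r → p ≈ r
≈-trans e f k = trans (e k) (f k)

≈-reflexive : ∀ {p q} → p ≡ q → p ≈ q
≈-reflexive refl = ≈-refl

≈-setoid : Setoid 0ℓ 0ℓ
≈-setoid = record
  { Carrier = Poly ; _≈_ = _≈_
  ; isEquivalence = record { refl = ≈-refl ; sym = ≈-sym ; trans = ≈-trans } }

module ≈-Reasoning = SetoidReasoning ≈-setoid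

0P : Poly
0P _ = + 0

scale : ℤ → Poly → Poly
scale s p k = s *ᶻ p k

shift : Poly → Poly
shift p zero    = + 0
shift p (suc k) = p k

ifP : Bool → Poly → Poly
ifP b p = if b then p else 0P

≡ᵇ-refl : ∀ a → (a ≡ᵇ a) ≡ true
≡ᵇ-refl zero    = refl
≡ᵇ-refl (suc a) = ≡ᵇ-refl a

≡ᵇ-false : ∀ {a b} → a ≢ b → (a ≡ᵇ b) ≡ false
≡ᵇ-false {zero}  {zero}  a≢b = ⊥-elim (a≢b refl)
≡ᵇ-false {zero}  {suc b} _   = refl
≡ᵇ-false {suc a} {zero}  _   = refl
≡ᵇ-false {suc a} {suc b} a≢b = ≡ᵇ-false (a≢b ∘ cong suc)

⊕-cong : ∀ {p p′ q q′} → p ≈ p′ → q ≈ q′ → p ⊕ q ≈ p′ ⊕ q′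
⊕-cong e f k = cong₂ _+ᶻ_ (e k) (f k)

⊕-identityˡ : ∀ {p q} → p ≈ 0P → p ⊕ q ≈ q
⊕-identityˡ {q = q} e k = trans (cong (_+ᶻ q k) (e k)) (ℤ.+-identityˡ (q k))

⊕-identityʳ : ∀ {p q} → q ≈ 0P → p ⊕ q ≈ p
⊕-identityʳ {p} e k = trans (cong (p k +ᶻ_) (e k)) (ℤ.+-identityʳ (p k))

constP-zero : constP (+ 0) ≈ 0P
constP-zero zero    = refl
constP-zero (suc k) = refl

scale-cong : ∀ s {p q} → p ≈ q → scale s p ≈ scale s q
scale-cong s e k = cong (s *ᶻ_) (e k)

scale-scale : ∀ s t p → scale s (scale t p) ≈ scale (s *ᶻ t) p
scale-scale s t p k = sym (ℤ.*-assoc s t (p k))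

scale-one : ∀ p → scale (+ 1) p ≈ p
scale-one p k = ℤ.*-identityˡ (p k)

scale-⊕ : ∀ s p q → scale s (p ⊕ q) ≈ scale s p ⊕ scale s q
scale-⊕ s p q k = ℤ.*-distribˡ-+ s (p k) (q k)

scale-zeroʳ : ∀ s {p} → p ≈ 0P → scale s p ≈ 0P
scale-zeroʳ s e k = trans (cong (s *ᶻ_) (e k)) (ℤ.*-zeroʳ s)

sumℤ-map-cong : ∀ (xs : List ℕ) {f g : ℕ → ℤ} → (∀ i → f i ≡ g i) →
  sumℤ (map f xs) ≡ sumℤ (map g xs)
sumℤ-map-cong []       e = refl
sumℤ-map-cong (x ∷ xs) e = cong₂ _+ᶻ_ (e x) (sumℤ-map-cong xs e)

sumℤ-map-+ : ∀ (xs : List ℕ) (f g : ℕ → ℤ) →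
  sumℤ (map (λ i → f i +ᶻ g i) xs) ≡ sumℤ (map f xs) +ᶻ sumℤ (map g xs)
sumℤ-map-+ []       f g = refl
sumℤ-map-+ (x ∷ xs) f g =
  trans (cong (f x +ᶻ g x +ᶻ_) (sumℤ-map-+ xs f g)) (interchange (f x) (g x) _ _)
  where
  interchange : ∀ a b c d → (a +ᶻ b) +ᶻ (c +ᶻ d) ≡ (a +ᶻ c) +ᶻ (b +ᶻ d)
  interchange = solve-∀

sumℤ-map-* : ∀ (xs : List ℕ) (s : ℤ) (f : ℕ → ℤ) →
  sumℤ (map (λ i → s *ᶻ f i) xs) ≡ s *ᶻ sumℤ (map f xs)
sumℤ-map-* []       s f = sym (ℤ.*-zeroʳ s)
sumℤ-map-* (x ∷ xs) s f =
  trans (cong (s *ᶻ f x +ᶻ_) (sumℤ-map-* xs s f)) (sym (ℤ.*-distribˡ-+ s (f x) _))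

sumℤ-map-zero : ∀ k (g : ℕ → ℕ) (f : ℕ → ℤ) → (∀ i → f (g i) ≡ + 0) →
  sumℤ (map f (applyUpTo g k)) ≡ + 0
sumℤ-map-zero zero    g f e = refl
sumℤ-map-zero (suc k) g f e = cong₂ _+ᶻ_ (e 0) (sumℤ-map-zero k (g ∘ suc) f (e ∘ suc))

⊛-cong : ∀ {p p′ q q′} → p ≈ p′ → q ≈ q′ → p ⊛ q ≈ p′ ⊛ q′
⊛-cong e f k = sumℤ-map-cong (upTo (suc k)) λ i → cong₂ _*ᶻ_ (e i) (f (k ∸ i))

⊛-congˡ : ∀ p {q q′} → q ≈ q′ → p ⊛ q ≈ p ⊛ q′
⊛-congˡ p {q} {q′} = ⊛-cong {p} {p} {q} {q′} ≈-refl

⊛-congʳ : ∀ {p p′} q → p ≈ p′ → p ⊛ q ≈ p′ ⊛ q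
⊛-congʳ {p} {p′} q e = ⊛-cong {p} {p′} {q} {q} e ≈-refl

⊛-distribˡ-⊕ : ∀ p q r → p ⊛ (q ⊕ r) ≈ (p ⊛ q) ⊕ (p ⊛ r)
⊛-distribˡ-⊕ p q r k = trans
  (sumℤ-map-cong (upTo (suc k)) λ i → ℤ.*-distribˡ-+ (p i) (q (k ∸ i)) (r (k ∸ i)))
  (sumℤ-map-+ (upTo (suc k)) (λ i → p i *ᶻ q (k ∸ i)) (λ i → p i *ᶻ r (k ∸ i)))

⊛-distribʳ-⊕ : ∀ p q r → (p ⊕ q) ⊛ r ≈ (p ⊛ r) ⊕ (q ⊛ r)
⊛-distribʳ-⊕ p q r k = trans
  (sumℤ-map-cong (upTo (suc k)) λ i → ℤ.*-distribʳ-+ (r (k ∸ i)) (p i) (q i))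
  (sumℤ-map-+ (upTo (suc k)) (λ i → p i *ᶻ r (k ∸ i)) (λ i → q i *ᶻ r (k ∸ i)))

⊛-scaleʳ : ∀ p s q → p ⊛ scale s q ≈ scale s (p ⊛ q)
⊛-scaleʳ p s q k = trans
  (sumℤ-map-cong (upTo (suc k)) λ i → swap (p i) s (q (k ∸ i)))
  (sumℤ-map-* (upTo (suc k)) s (λ i → p i *ᶻ q (k ∸ i)))
  where
  swap : ∀ a b c → a *ᶻ (b *ᶻ c) ≡ b *ᶻ (a *ᶻ c)
  swap = solve-∀

scale-⊛-scale : ∀ s A t D → scale s (A ⊛ scale t D) ≈ scale (s *ᶻ t) (A ⊛ D)
scale-⊛-scale s A t D = ≈-trans (scale-cong s (⊛-scaleʳ A t D)) (scale-scale s t (A ⊛ D))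

⊛-zeroˡ : ∀ {p} q → p ≈ 0P → p ⊛ q ≈ 0P
⊛-zeroˡ q e = ≈-trans (⊛-congʳ q e) (λ k → sumℤ-map-zero (suc k) id _ λ _ → refl)

⊛-zeroʳ : ∀ p {q} → q ≈ 0P → p ⊛ q ≈ 0P
⊛-zeroʳ p e = ≈-trans (⊛-congˡ p e)
  (λ k → sumℤ-map-zero (suc k) id (λ i → p i *ᶻ + 0) λ i → ℤ.*-zeroʳ (p i))

constP-⊛ : ∀ c p → constP c ⊛ p ≈ scale c p
constP-⊛ c p k =
  trans (cong (c *ᶻ p k +ᶻ_) (sumℤ-map-zero k suc _ λ _ → refl)) (ℤ.+-identityʳ (c *ᶻ p k))

X-⊛ : ∀ p → X ⊛ p ≈ shift p
X-⊛ p zero    = refl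
X-⊛ p (suc k) = trans (ℤ.+-identityˡ _)
  (trans (cong (+ 1 *ᶻ p k +ᶻ_) (sumℤ-map-zero k (suc ∘ suc) _ λ _ → refl))
         (trans (ℤ.+-identityʳ (+ 1 *ᶻ p k)) (ℤ.*-identityˡ (p k))))

infixr 7 X^_·_
X^_·_ : ℕ → Poly → Poly
X^ zero  · p = p
X^ suc a · p = shift (X^ a · p)

X^-cong : ∀ a {p q} → p ≈ q → X^ a · p ≈ X^ a · q
X^-cong zero    e k       = e k
X^-cong (suc a) e zero    = refl
X^-cong (suc a) e (suc k) = X^-cong a e k

X^-scale : ∀ a s p → X^ a · scale s p ≈ scale s (X^ a · p)
X^-scale zero    s p k       = refl
X^-scale (suc a) s p zero    = sym (ℤ.*-zeroʳ s)
X^-scale (suc a) s p (suc k) = X^-scale a s p k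

monoP-if : ∀ c m k → monoP c m k ≡ (if m ≡ᵇ k then c else + 0)
monoP-if c m k with m ≡ᵇ k
... | true  = refl
... | false = refl

constP-monoP : ∀ c → constP c ≈ monoP c 0
constP-monoP c zero    = refl
constP-monoP c (suc k) = refl

scale-monoP : ∀ s c m → scale s (monoP c m) ≈ monoP (s *ᶻ c) m
scale-monoP s c m k =
  trans (cong (s *ᶻ_) (monoP-if c m k)) (trans (scale-if (m ≡ᵇ k)) (sym (monoP-if (s *ᶻ c) m k)))
  where
  scale-if : ∀ b → s *ᶻ (if b then c else + 0) ≡ (if b then s *ᶻ c else + 0)
  scale-if true  = refl
  scale-if false = ℤ.*-zeroʳ s

X^-monoP : ∀ a c m → X^ a · monoP c m ≈ monoP c (a + m)
X^-monoP zero    c m k       = refl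
X^-monoP (suc a) c m zero    = sym (monoP-if c (suc (a + m)) zero)
X^-monoP (suc a) c m (suc k) =
  trans (X^-monoP a c m k) (trans (monoP-if c (a + m) k) (sym (monoP-if c (suc (a + m)) (suc k))))

monoP-≡ : ∀ {c c′ m m′} → c ≡ c′ → m ≡ m′ → monoP c m ≈ monoP c′ m′
monoP-≡ refl refl = ≈-refl

X^-constP : ∀ a c → X^ a · constP c ≈ monoP c a
X^-constP a c = ≈-trans (X^-cong a (constP-monoP c)) (≈-trans (X^-monoP a c 0) (monoP-≡ refl (ℕ.+-identityʳ a)))

constP-⊛-monoP : ∀ a b m → constP a ⊛ monoP b m ≈ monoP (a *ᶻ b) m
constP-⊛-monoP a b m = ≈-trans (constP-⊛ a (monoP b m)) (scale-monoP a b m)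

⊕-assoc : ∀ p q r → (p ⊕ q) ⊕ r ≈ p ⊕ (q ⊕ r)
⊕-assoc p q r k = ℤ.+-assoc (p k) (q k) (r k)

constP-+ : ∀ a b → constP (a +ᶻ b) ≈ constP a ⊕ constP b
constP-+ a b zero    = refl
constP-+ a b (suc k) = refl

constP-*-ind : ∀ a b → constP (a *ᶻ ind b) ≈ ifP b (constP a)
constP-*-ind a true  = ≈-reflexive (cong constP (ℤ.*-identityʳ a))
constP-*-ind a false = ≈-trans (≈-reflexive (cong constP (ℤ.*-zeroʳ a))) constP-zero

if-constP-zero : ∀ b p → (if b then p else constP (+ 0)) ≈ ifP b p
if-constP-zero true  p = ≈-refl
if-constP-zero false p = constP-zero

constP-*-ind₃ : ∀ α β γ a b c → constP (α *ᶻ ind a +ᶻ (β *ᶻ ind b +ᶻ γ *ᶻ ind c))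
  ≈ ifP a (constP α) ⊕ (ifP b (constP β) ⊕ ifP c (constP γ))
constP-*-ind₃ α β γ a b c = ≈-trans (constP-+ (α *ᶻ ind a) _)
  (⊕-cong (constP-*-ind α a) (≈-trans (constP-+ (β *ᶻ ind b) _) (⊕-cong (constP-*-ind β b) (constP-*-ind γ c))))

punchInℕ : ℕ → ℕ → ℕ
punchInℕ p j = if j <ᵇ p then j else suc j

punchOutℕ : ℕ → ℕ → ℕ
punchOutℕ zero    b       = b ∸ 1
punchOutℕ (suc p) zero    = zero
punchOutℕ (suc p) (suc b) = suc (punchOutℕ p b)

punchInℕ-suc : ∀ p j → punchInℕ (suc p) (suc j) ≡ suc (punchInℕ p j)
punchInℕ-suc p j with j <ᵇ p
... | true  = refl
... | false = refl

toℕ-punchIn : ∀ {m} (p : Fin (suc m)) (j : Fin m) → toℕ (punchIn p j) ≡ punchInℕ (toℕ p) (toℕ j)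
toℕ-punchIn fzero    j        = refl
toℕ-punchIn (fsuc p) fzero    = refl
toℕ-punchIn (fsuc p) (fsuc j) = trans (cong suc (toℕ-punchIn p j)) (sym (punchInℕ-suc (toℕ p) (toℕ j)))

punchInℕ-below : ∀ {p j} → j < p → punchInℕ p j ≡ j
punchInℕ-below {suc p} {zero}  _         = refl
punchInℕ-below {suc p} {suc j} (s≤s j<p) = trans (punchInℕ-suc p j) (cong suc (punchInℕ-below j<p))

punchInℕ-above : ∀ {p j} → p ≤ j → punchInℕ p j ≡ suc j
punchInℕ-above {zero}  {j}     _         = refl
punchInℕ-above {suc p} {suc j} (s≤s p≤j) = trans (punchInℕ-suc p j) (cong suc (punchInℕ-above p≤j))

punchInℕ≤suc : ∀ p j → punchInℕ p j ≤ suc j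
punchInℕ≤suc p j with j <ᵇ p
... | true  = ℕ.n≤1+n j
... | false = ℕ.≤-refl

punchInℕ-bound : ∀ p {j m} → j < m → punchInℕ p j < suc m
punchInℕ-bound p {j} j<m = s≤s (ℕ.≤-trans (punchInℕ≤suc p j) j<m)

punchInℕᵢ≢i : ∀ p j → punchInℕ p j ≢ p
punchInℕᵢ≢i zero    j       ()
punchInℕᵢ≢i (suc p) zero    ()
punchInℕᵢ≢i (suc p) (suc j) e = punchInℕᵢ≢i p j (ℕ.suc-injective (trans (sym (punchInℕ-suc p j)) e))

punchInℕ-injective : ∀ p i j → punchInℕ p i ≡ punchInℕ p j → i ≡ j
punchInℕ-injective zero    i       j       e = ℕ.suc-injective e
punchInℕ-injective (suc p) zero    zero    e = refl
punchInℕ-injective (suc p) zero    (suc j) e with trans e (punchInℕ-suc p j)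
... | ()
punchInℕ-injective (suc p) (suc i) zero    e with trans (sym (punchInℕ-suc p i)) e
... | ()
punchInℕ-injective (suc p) (suc i) (suc j) e = cong suc (punchInℕ-injective p i j
  (ℕ.suc-injective (trans (sym (punchInℕ-suc p i)) (trans e (punchInℕ-suc p j)))))

punchInℕ-punchOutℕ : ∀ {p b} → b ≢ p → punchInℕ p (punchOutℕ p b) ≡ b
punchInℕ-punchOutℕ {zero}  {zero}  b≢p = ⊥-elim (b≢p refl)
punchInℕ-punchOutℕ {zero}  {suc b} b≢p = refl
punchInℕ-punchOutℕ {suc p} {zero}  b≢p = refl
punchInℕ-punchOutℕ {suc p} {suc b} b≢p =
  trans (punchInℕ-suc p (punchOutℕ p b)) (cong suc (punchInℕ-punchOutℕ (b≢p ∘ cong suc)))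

punchOutℕ-bound : ∀ {p b n} → b ≢ p → b < suc n → p < suc n → punchOutℕ p b < n
punchOutℕ-bound {zero}  {zero}  b≢p _ _ = ⊥-elim (b≢p refl)
punchOutℕ-bound {zero}  {suc b} _ (s≤s b<) _ = b<
punchOutℕ-bound {suc p} {zero}  {suc n} _ _ _ = s≤s z≤n
punchOutℕ-bound {suc p} {zero}  {zero}  _ _ (s≤s ())
punchOutℕ-bound {suc p} {suc b} {suc n} b≢p (s≤s b<) (s≤s p<) =
  s≤s (punchOutℕ-bound (b≢p ∘ cong suc) b< p<)

-- Deleting column b and then column j of what remains deletes the same two columns as
-- deleting column punchInℕ b j first and then the remaining copy of column b.
punchInℕ-swap : ∀ b j i →
  punchInℕ (punchInℕ b j) (punchInℕ (punchOutℕ (punchInℕ b j) b) i) ≡ punchInℕ b (punchInℕ j i)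
punchInℕ-swap zero    j       i = punchInℕ-suc j i
punchInℕ-swap (suc b) zero    i = sym (punchInℕ-suc b i)
punchInℕ-swap (suc b) (suc j) i rewrite punchInℕ-suc b j with i
... | zero  = refl
... | suc i rewrite punchInℕ-suc (punchOutℕ (punchInℕ b j) b) i
                  | punchInℕ-suc (punchInℕ b j) (punchInℕ (punchOutℕ (punchInℕ b j) b) i)
                  | punchInℕ-suc j i | punchInℕ-suc b (punchInℕ j i) = cong suc (punchInℕ-swap b j i)

sign-+ : ∀ a b → sign (a + b) ≡ sign a *ᶻ sign b
sign-+ zero    b = sym (ℤ.*-identityˡ (sign b))
sign-+ (suc a) b = trans (cong -_ (sign-+ a b)) (ℤ.neg-distribˡ-* (sign a) (sign b))

sign-sq : ∀ b → sign b *ᶻ sign b ≡ + 1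
sign-sq zero    = refl
sign-sq (suc b) = trans (neg-sq (sign b)) (sign-sq b)
  where
  neg-sq : ∀ x → (- x) *ᶻ (- x) ≡ x *ᶻ x
  neg-sq = solve-∀

sign-punchInℕ-swap : ∀ b j → sign (punchInℕ b j) *ᶻ sign (punchOutℕ (punchInℕ b j) b) ≡ - (sign b *ᶻ sign j)
sign-punchInℕ-swap zero    j = regroup (sign j)
  where
  regroup : ∀ x → (- x) *ᶻ + 1 ≡ - (+ 1 *ᶻ x)
  regroup = solve-∀
sign-punchInℕ-swap (suc b) zero = regroup (sign b)
  where
  regroup : ∀ x → + 1 *ᶻ x ≡ - ((- x) *ᶻ + 1)
  regroup = solve-∀
sign-punchInℕ-swap (suc b) (suc j) rewrite punchInℕ-suc b j =
  trans (neg-*-neg (sign (punchInℕ b j)) _)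
        (trans (sign-punchInℕ-swap b j) (cong -_ (sym (neg-*-neg (sign b) (sign j)))))
  where
  neg-*-neg : ∀ x y → (- x) *ᶻ (- y) ≡ x *ᶻ y
  neg-*-neg = solve-∀

Matrix : Set
Matrix = ℕ → ℕ → Poly

minor : ℕ → ℕ → Matrix → Matrix
minor r b E i j = E (punchInℕ r i) (punchInℕ b j)

sumP : ℕ → (ℕ → Poly) → Poly
sumP zero    f = 0P
sumP (suc m) f = f 0 ⊕ sumP m (f ∘ suc)

sumF-cong : ∀ {m} (f g : Fin m → Poly) → (∀ j → f j ≈ g j) → sumF f ≈ sumF g
sumF-cong {zero}  f g e k = refl
sumF-cong {suc m} f g e k = cong₂ _+ᶻ_ (e fzero k) (sumF-cong (f ∘ fsuc) (g ∘ fsuc) (e ∘ fsuc) k)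

sumF-toℕ : ∀ m (g : ℕ → Poly) → sumF {m} (g ∘ toℕ) ≈ sumP m g
sumF-toℕ zero    g k = refl
sumF-toℕ (suc m) g k = cong (g 0 k +ᶻ_) (sumF-toℕ m (g ∘ suc) k)

det-cong : ∀ {m} (M N : Fin m → Fin m → Poly) → (∀ r c → M r c ≈ N r c) → det M ≈ det N
det-cong {zero}  M N e = ≈-refl
det-cong {suc m} M N e = sumF-cong _ _ λ j → ⊛-congˡ (constP (sign (toℕ j)))
  (⊛-cong (e fzero j) (det-cong (λ r c → M (fsuc r) (punchIn j c)) (λ r c → N (fsuc r) (punchIn j c))
    λ r c → e (fsuc r) (punchIn j c)))

-- Opaque, so that unification never unfolds a determinant.
opaque
  detℕ : ℕ → Matrix → Poly
  detℕ m E = det {m} λ r c → E (toℕ r) (toℕ c)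

  det≈detℕ : ∀ {m} E → det {m} (λ r c → E (toℕ r) (toℕ c)) ≈ detℕ m E
  det≈detℕ E = ≈-refl

  detℕ-empty : ∀ E → detℕ 0 E ≈ constP (+ 1)
  detℕ-empty E = ≈-refl

  detℕ-cong : ∀ m {E F : Matrix} → (∀ i j → i < m → j < m → E i j ≈ F i j) → detℕ m E ≈ detℕ m F
  detℕ-cong m e = det-cong _ _ λ r c → e (toℕ r) (toℕ c) (Fin.toℕ<n r) (Fin.toℕ<n c)

detℕ-size : ∀ {m m′} E → m ≡ m′ → detℕ m E ≈ detℕ m′ E
detℕ-size E refl = ≈-refl

laplaceTerm : ℕ → Matrix → ℕ → Poly
laplaceTerm m E j = scale (sign j) (E 0 j ⊛ detℕ m (minor 0 j E))

opaque
  unfolding detℕ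

  detℕ-expand : ∀ m E → detℕ (suc m) E ≈ sumP (suc m) (laplaceTerm m E)
  detℕ-expand m E = ≈-trans (sumF-cong summand (laplaceTerm m E ∘ toℕ) term)
    (sumF-toℕ (suc m) (laplaceTerm m E))
    where
    summand : Fin (suc m) → Poly
    summand j = constP (sign (toℕ j)) ⊛ (E 0 (toℕ j) ⊛ det (λ r c → E (suc (toℕ r)) (toℕ (punchIn j c))))
    term : ∀ j → summand j ≈ laplaceTerm m E (toℕ j)
    term j = ≈-trans (constP-⊛ (sign (toℕ j)) _) (scale-cong (sign (toℕ j)) (⊛-congˡ (E 0 (toℕ j))
      (det-cong _ _ λ r c k → cong (λ z → E (suc (toℕ r)) z k) (toℕ-punchIn j c))))

sumP-cong : ∀ m f g → (∀ j → j < m → f j ≈ g j) → sumP m f ≈ sumP m g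
sumP-cong zero    f g e k = refl
sumP-cong (suc m) f g e k =
  cong₂ _+ᶻ_ (e 0 (s≤s z≤n) k) (sumP-cong m (f ∘ suc) (g ∘ suc) (λ j → e (suc j) ∘ s≤s) k)

sumP-zero : ∀ m f → (∀ j → j < m → f j ≈ 0P) → sumP m f ≈ 0P
sumP-zero zero    f e k = refl
sumP-zero (suc m) f e k = cong₂ _+ᶻ_ (e 0 (s≤s z≤n) k) (sumP-zero m (f ∘ suc) (λ j → e (suc j) ∘ s≤s) k)

sumP-⊕ : ∀ m f g → sumP m (λ j → f j ⊕ g j) ≈ sumP m f ⊕ sumP m g
sumP-⊕ zero    f g k = refl
sumP-⊕ (suc m) f g k =
  trans (cong (f 0 k +ᶻ g 0 k +ᶻ_) (sumP-⊕ m (f ∘ suc) (g ∘ suc) k))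
    (interchange (f 0 k) (g 0 k) (sumP m (f ∘ suc) k) (sumP m (g ∘ suc) k))
  where
  interchange : ∀ a b c d → (a +ᶻ b) +ᶻ (c +ᶻ d) ≡ (a +ᶻ c) +ᶻ (b +ᶻ d)
  interchange = solve-∀

sumP-scale : ∀ m s f → sumP m (λ j → scale s (f j)) ≈ scale s (sumP m f)
sumP-scale zero    s f k = sym (ℤ.*-zeroʳ s)
sumP-scale (suc m) s f k =
  trans (cong (s *ᶻ f 0 k +ᶻ_) (sumP-scale m s (f ∘ suc) k)) (sym (ℤ.*-distribˡ-+ s (f 0 k) _))

sumP-single : ∀ m f b → b < m → (∀ j → j < m → j ≢ b → f j ≈ 0P) → sumP m f ≈ f b
sumP-single (suc m) f zero    _         e =
  ⊕-identityʳ (sumP-zero m (f ∘ suc) λ j j< → e (suc j) (s≤s j<) λ ())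
sumP-single (suc m) f (suc b) (s≤s b<m) e =
  ≈-trans (⊕-identityˡ (e 0 (s≤s z≤n) λ ()))
    (sumP-single m (f ∘ suc) b b<m λ j j< j≢b → e (suc j) (s≤s j<) (j≢b ∘ ℕ.suc-injective))

sumP-split : ∀ m f b → b < suc m → sumP (suc m) f ≈ f b ⊕ sumP m (f ∘ punchInℕ b)
sumP-split m       f zero    _ = ≈-refl
sumP-split (suc m) f (suc b) (s≤s b<) k =
  trans (cong (f 0 k +ᶻ_) (trans (sumP-split m (f ∘ suc) b b< k)
          (cong (f (suc b) k +ᶻ_) (sumP-cong m _ _ (λ j _ k′ → cong (λ z → f z k′) (sym (punchInℕ-suc b j))) k))))
    (exchange (f 0 k) (f (suc b) k) _)
  where
  exchange : ∀ a b c → a +ᶻ (b +ᶻ c) ≡ b +ᶻ (a +ᶻ c)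
  exchange = solve-∀

detℕ-row0-single : ∀ m E b → b < suc m → (∀ j → j < suc m → j ≢ b → E 0 j ≈ 0P) →
  detℕ (suc m) E ≈ laplaceTerm m E b
detℕ-row0-single m E b b< e = ≈-trans (detℕ-expand m E)
  (sumP-single (suc m) (laplaceTerm m E) b b< λ j j< j≢b →
    scale-zeroʳ (sign j) (⊛-zeroˡ (detℕ m (minor 0 j E)) (e j j< j≢b)))

detℕ-additive-termwise : ∀ m E E₁ E₂ →
  (∀ j → j < suc m → laplaceTerm m E j ≈ laplaceTerm m E₁ j ⊕ laplaceTerm m E₂ j) →
  detℕ (suc m) E ≈ detℕ (suc m) E₁ ⊕ detℕ (suc m) E₂
detℕ-additive-termwise m E E₁ E₂ t =
  ≈-trans (detℕ-expand m E)
  (≈-trans (sumP-cong (suc m) _ (λ j → laplaceTerm m E₁ j ⊕ laplaceTerm m E₂ j) t)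
  (≈-trans (sumP-⊕ (suc m) (laplaceTerm m E₁) (laplaceTerm m E₂))
           (⊕-cong (≈-sym (detℕ-expand m E₁)) (≈-sym (detℕ-expand m E₂)))))

detℕ-linear-row : ∀ m r E E₁ E₂ → r < m →
  (∀ j → j < m → E r j ≈ E₁ r j ⊕ E₂ r j) →
  (∀ i j → i < m → j < m → i ≢ r → E i j ≈ E₁ i j) →
  (∀ i j → i < m → j < m → i ≢ r → E i j ≈ E₂ i j) →
  detℕ m E ≈ detℕ m E₁ ⊕ detℕ m E₂
detℕ-linear-row (suc m) zero E E₁ E₂ _ row e₁ e₂ = detℕ-additive-termwise m E E₁ E₂ λ j j< →
  let D = detℕ m (minor 0 j E) in
  ≈-trans (scale-cong (sign j) (≈-trans (⊛-congʳ D (row j j<)) (⊛-distribʳ-⊕ (E₁ 0 j) (E₂ 0 j) D)))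
  (≈-trans (scale-⊕ (sign j) (E₁ 0 j ⊛ D) (E₂ 0 j ⊛ D))
    (⊕-cong (scale-cong (sign j) (⊛-congˡ (E₁ 0 j) (minors-agree j e₁)))
            (scale-cong (sign j) (⊛-congˡ (E₂ 0 j) (minors-agree j e₂)))))
  where
  minors-agree : ∀ {F} j → (∀ i j → i < suc m → j < suc m → i ≢ 0 → E i j ≈ F i j) →
    detℕ m (minor 0 j E) ≈ detℕ m (minor 0 j F)
  minors-agree j e = detℕ-cong m λ i c i< c< → e (suc i) _ (s≤s i<) (punchInℕ-bound j c<) λ ()
detℕ-linear-row (suc m) (suc r) E E₁ E₂ (s≤s r<) row e₁ e₂ = detℕ-additive-termwise m E E₁ E₂ λ j j< →
  let D₁ = detℕ m (minor 0 j E₁)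
      D₂ = detℕ m (minor 0 j E₂) in
  ≈-trans (scale-cong (sign j) (≈-trans (⊛-congˡ (E 0 j) (minors-split j)) (⊛-distribˡ-⊕ (E 0 j) D₁ D₂)))
  (≈-trans (scale-⊕ (sign j) (E 0 j ⊛ D₁) (E 0 j ⊛ D₂))
    (⊕-cong (scale-cong (sign j) (⊛-congʳ D₁ (e₁ 0 j (s≤s z≤n) j< λ ())))
            (scale-cong (sign j) (⊛-congʳ D₂ (e₂ 0 j (s≤s z≤n) j< λ ())))))
  where
  minors-split : ∀ j → detℕ m (minor 0 j E) ≈ detℕ m (minor 0 j E₁) ⊕ detℕ m (minor 0 j E₂)
  minors-split j = detℕ-linear-row m r (minor 0 j E) (minor 0 j E₁) (minor 0 j E₂) r<
    (λ c c< → row _ (punchInℕ-bound j c<))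
    (λ i c i< c< i≢r → e₁ (suc i) _ (s≤s i<) (punchInℕ-bound j c<) (i≢r ∘ ℕ.suc-injective))
    (λ i c i< c< i≢r → e₂ (suc i) _ (s≤s i<) (punchInℕ-bound j c<) (i≢r ∘ ℕ.suc-injective))

detℕ-zero-row : ∀ m r E → r < m → (∀ j → j < m → E r j ≈ 0P) → detℕ m E ≈ 0P
detℕ-zero-row (suc m) zero E _ z = ≈-trans (detℕ-expand m E) (sumP-zero (suc m) _ λ j j< →
  scale-zeroʳ (sign j) (⊛-zeroˡ (detℕ m (minor 0 j E)) (z j j<)))
detℕ-zero-row (suc m) (suc r) E (s≤s r<) z = ≈-trans (detℕ-expand m E) (sumP-zero (suc m) _ λ j j< →
  scale-zeroʳ (sign j) (⊛-zeroʳ (E 0 j)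
    (detℕ-zero-row m r (minor 0 j E) r< λ c c< → z _ (punchInℕ-bound j c<))))

detℕ-row-single : ∀ m r b c E → r < suc m → b < suc m → E r b ≈ constP c →
  (∀ j → j < suc m → j ≢ b → E r j ≈ 0P) →
  detℕ (suc m) E ≈ scale (c *ᶻ sign (r + b)) (detℕ m (minor r b E))
-- Expand along row 0: the column-b term vanishes, since its minor keeps row r without its only
-- nonzero entry; the minors of the other terms are expanded along row r by induction.
detℕ-row-single m zero b c E _ b< at off =
  ≈-trans (detℕ-row0-single m E b b< off)
  (≈-trans (scale-cong (sign b) (≈-trans (⊛-congʳ D at) (constP-⊛ c D)))
  (≈-trans (scale-scale (sign b) c D) λ k → cong (_*ᶻ D k) (ℤ.*-comm (sign b) c)))
  where
  D = detℕ m (minor 0 b E)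
detℕ-row-single (suc m) (suc r) b c E (s≤s r<) b< at off =
  ≈-trans (detℕ-expand (suc m) E)
  (≈-trans (sumP-split (suc m) (laplaceTerm (suc m) E) b b<)
  (≈-trans (⊕-identityˡ column-b-term)
  (≈-trans (sumP-cong (suc m) _ (λ j → scale K (laplaceTerm m F j)) other-term)
  (≈-trans (sumP-scale (suc m) K (laplaceTerm m F)) (scale-cong K (≈-sym (detℕ-expand m F)))))))
  where
  K = c *ᶻ sign (suc r + b)
  F = minor (suc r) b E
  column-b-term : laplaceTerm (suc m) E b ≈ 0P
  column-b-term = scale-zeroʳ (sign b) (⊛-zeroʳ (E 0 b) (detℕ-zero-row (suc m) r (minor 0 b E) r< λ j j< →
    off (punchInℕ b j) (punchInℕ-bound b j<) (punchInℕᵢ≢i b j)))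
  other-term : ∀ j → j < suc m → laplaceTerm (suc m) E (punchInℕ b j) ≈ scale K (laplaceTerm m F j)
  other-term j j< =
    ≈-trans (scale-cong (sign p) (⊛-congˡ (E 0 p) minor-expanded))
    (≈-trans (scale-⊛-scale (sign p) (E 0 p) (c *ᶻ sign (r + u)) D)
    (≈-trans (λ k → cong (_*ᶻ (E 0 p ⊛ D) k) coefficient)
    (≈-trans (≈-sym (scale-scale K (sign j) (E 0 p ⊛ D)))
      (scale-cong K (scale-cong (sign j) (⊛-congˡ (E 0 p) minors-agree))))))
    where
    p = punchInℕ b j
    u = punchOutℕ p b
    b≢p : b ≢ p
    b≢p = punchInℕᵢ≢i b j ∘ sym
    D = detℕ m (minor r u (minor 0 p E))
    minor-expanded : detℕ (suc m) (minor 0 p E) ≈ scale (c *ᶻ sign (r + u)) D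
    minor-expanded = detℕ-row-single m r u c (minor 0 p E) r<
      (punchOutℕ-bound b≢p b< (punchInℕ-bound b j<))
      (λ k → trans (cong (λ z → E (suc r) z k) (punchInℕ-punchOutℕ b≢p)) (at k))
      (λ j′ j′< j′≢u → off (punchInℕ p j′) (punchInℕ-bound p j′<) λ e →
        j′≢u (punchInℕ-injective p j′ u (trans e (sym (punchInℕ-punchOutℕ b≢p)))))
    minors-agree : D ≈ detℕ m (minor 0 j F)
    minors-agree = detℕ-cong m λ i j′ _ _ k →
      cong₂ (λ y z → E y z k) (sym (punchInℕ-suc r i)) (punchInℕ-swap b j j′)
    coefficient : sign p *ᶻ (c *ᶻ sign (r + u)) ≡ K *ᶻ sign j
    coefficient rewrite sign-+ r u | sign-+ r b =
      trans (regroup (sign p) (sign u) c (sign r))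
        (trans (cong (λ z → c *ᶻ sign r *ᶻ z) (sign-punchInℕ-swap b j)) (finish c (sign r) (sign b) (sign j)))
      where
      regroup : ∀ sp su c sr → sp *ᶻ (c *ᶻ (sr *ᶻ su)) ≡ c *ᶻ sr *ᶻ (sp *ᶻ su)
      regroup = solve-∀
      finish : ∀ c sr sb sj → c *ᶻ sr *ᶻ (- (sb *ᶻ sj)) ≡ (c *ᶻ (- (sr *ᶻ sb))) *ᶻ sj
      finish = solve-∀

detℕ-zero-bottomLeft : ∀ t m E → t < m → (∀ i j → t ≤ i → i < m → j ≤ t → E i j ≈ 0P) → detℕ m E ≈ 0P
detℕ-zero-bottomLeft zero (suc m) E _ z = ≈-trans (detℕ-expand m E)
  (≈-trans (⊕-identityʳ (sumP-zero m _ λ j j< → scale-zeroʳ (sign (suc j)) (⊛-zeroʳ (E 0 (suc j))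
    (detℕ-zero-bottomLeft zero m (minor 0 (suc j) E) (ℕ.<-≤-trans (s≤s z≤n) j<)
      λ { i zero _ i< z≤n → z (suc i) 0 z≤n (s≤s i<) z≤n }))))
  (scale-zeroʳ (+ 1) (⊛-zeroˡ (detℕ m (minor 0 0 E)) (z 0 0 z≤n (s≤s z≤n) z≤n))))
detℕ-zero-bottomLeft (suc t) (suc m) E (s≤s t<) z = ≈-trans (detℕ-expand m E) (sumP-zero (suc m) _ λ j j< →
  scale-zeroʳ (sign j) (⊛-zeroʳ (E 0 j) (detℕ-zero-bottomLeft t m (minor 0 j E) t< λ i j′ t≤i i< j′≤t →
    z (suc i) _ (s≤s t≤i) (s≤s i<) (ℕ.≤-trans (punchInℕ≤suc j j′) (s≤s j′≤t)))))

detℕ-zero-topRight : ∀ t m E → t < m → (∀ i j → i ≤ t → t ≤ j → j < m → E i j ≈ 0P) → detℕ m E ≈ 0P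
detℕ-zero-topRight zero (suc m) E _ z = ≈-trans (detℕ-expand m E) (sumP-zero (suc m) _ λ j j< →
  scale-zeroʳ (sign j) (⊛-zeroˡ (detℕ m (minor 0 j E)) (z 0 j z≤n z≤n j<)))
detℕ-zero-topRight (suc t) (suc m) E (s≤s t<) z = ≈-trans (detℕ-expand m E) (sumP-zero (suc m) _ term)
  where
  term : ∀ j → j < suc m → laplaceTerm m E j ≈ 0P
  term j j< with suc t ℕ.≤? j
  ... | yes t<j = scale-zeroʳ (sign j) (⊛-zeroˡ (detℕ m (minor 0 j E)) (z 0 j z≤n t<j j<))
  ... | no  t≮j = scale-zeroʳ (sign j) (⊛-zeroʳ (E 0 j) (detℕ-zero-topRight t m (minor 0 j E) t<
        λ i j′ i≤t t≤j′ j′< → subst (λ c → E (suc i) c ≈ 0P)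
          (sym (punchInℕ-above (ℕ.≤-trans (ℕ.≤-pred (ℕ.≰⇒> t≮j)) t≤j′)))
          (z (suc i) (suc j′) (s≤s i≤t) (s≤s t≤j′) (s≤s j′<))))

-- Row r ≥ 1 of x·I − C_n, indices starting at 0.
bidiagonalRow : ℕ → ℕ → Poly
bidiagonalRow r c = ifP (r ≡ᵇ c) X ⊕ ifP (r ≡ᵇ suc c) (constP (- (+ 1)))

bidiagonalRow-shift : ∀ a r c → bidiagonalRow (a + r) (a + c) ≡ bidiagonalRow r c
bidiagonalRow-shift zero    r c = refl
bidiagonalRow-shift (suc a) r c = bidiagonalRow-shift a r c

bidiagonalRow-off : ∀ {r c} → r ≢ c → r ≢ suc c → bidiagonalRow r c ≈ 0P
bidiagonalRow-off {r} {c} r≢c r≢1+c k rewrite ≡ᵇ-false r≢c | ≡ᵇ-false r≢1+c = refl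

detℕ-bidiagonal-block : ∀ s c m E → c ≤ s → s ≤ m →
  (∀ i j → i < s → j < m → E i j ≈ bidiagonalRow (suc i) (punchInℕ c j)) →
  (∀ i j → s ≤ i → i < m → j < s → E i j ≈ 0P) →
  detℕ m E ≈ scale (sign c) (X^ (s ∸ c) · detℕ (m ∸ s) (λ i j → E (s + i) (s + j)))
detℕ-bidiagonal-block zero zero m E _ _ _ _ = ≈-sym (scale-one (detℕ m E))
detℕ-bidiagonal-block (suc s) zero (suc m) E _ (s≤s s≤m) top bottom =
  ≈-trans (detℕ-row0-single m E 0 (s≤s z≤n) row0-off)
  (≈-trans (scale-cong (+ 1) (⊛-cong e00 ih))
  (≈-trans (scale-⊛-scale (+ 1) X (+ 1) (X^ s · L)) (scale-cong (+ 1) (X-⊛ (X^ s · L)))))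
  where
  L = detℕ (m ∸ s) (λ i j → E (suc (s + i)) (suc (s + j)))
  row0-off : ∀ j → j < suc m → j ≢ 0 → E 0 j ≈ 0P
  row0-off zero    _  0≢0 = ⊥-elim (0≢0 refl)
  row0-off (suc j) j< _   = top 0 (suc j) (s≤s z≤n) j<
  e00 : E 0 0 ≈ X
  e00 = ≈-trans (top 0 0 (s≤s z≤n) (s≤s z≤n)) λ k → ℤ.+-identityʳ (X k)
  ih : detℕ m (minor 0 0 E) ≈ scale (+ 1) (X^ s · L)
  ih = detℕ-bidiagonal-block s 0 m (minor 0 0 E) z≤n s≤m
    (λ i j i< j< → top (suc i) (suc j) (s≤s i<) (s≤s j<))
    (λ i j s≤i i< j< → bottom (suc i) (suc j) (s≤s s≤i) (s≤s i<) (s≤s j<))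
detℕ-bidiagonal-block (suc s) (suc c) (suc m) E (s≤s c≤s) (s≤s s≤m) top bottom =
  ≈-trans (detℕ-expand m E)
  (≈-trans (⊕-identityʳ other-terms)
  (≈-trans (scale-cong (+ 1) (⊛-cong e00 ih))
  (≈-trans (scale-⊛-scale (+ 1) (constP (- (+ 1))) (sign c) P)
  (≈-trans (scale-cong (+ 1 *ᶻ sign c) (constP-⊛ (- (+ 1)) P))
  (≈-trans (scale-scale (+ 1 *ᶻ sign c) (- (+ 1)) P) λ k → cong (_*ᶻ P k) (coefficient (sign c)))))))
  where
  L = detℕ (m ∸ s) (λ i j → E (suc (s + i)) (suc (s + j)))
  P = X^ (s ∸ c) · L
  column0 : ∀ i → i < m → E (suc i) 0 ≈ 0P
  column0 i i< with suc i ℕ.<? suc s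
  ... | yes i<s = top (suc i) 0 i<s (s≤s z≤n)
  ... | no  i≮s = bottom (suc i) 0 (ℕ.≮⇒≥ i≮s) (s≤s i<) (s≤s z≤n)
  -- the terms j ≥ 1 vanish: their minors keep column 0, which is zero below row 0
  other-terms : sumP m (laplaceTerm m E ∘ suc) ≈ 0P
  other-terms = sumP-zero m _ λ j j< → scale-zeroʳ (sign (suc j)) (⊛-zeroʳ (E 0 (suc j))
    (detℕ-zero-bottomLeft 0 m (minor 0 (suc j) E) (ℕ.<-≤-trans (s≤s z≤n) j<)
      λ { i zero _ i< z≤n → column0 i i< }))
  e00 : E 0 0 ≈ constP (- (+ 1))
  e00 = ≈-trans (top 0 0 (s≤s z≤n) (s≤s z≤n)) λ k → ℤ.+-identityˡ _
  ih : detℕ m (minor 0 0 E) ≈ scale (sign c) P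
  ih = detℕ-bidiagonal-block s c m (minor 0 0 E) c≤s s≤m
    (λ i j i< j< k → trans (top (suc i) (suc j) (s≤s i<) (s≤s j<) k)
                           (cong (λ w → bidiagonalRow (suc (suc i)) w k) (punchInℕ-suc c j)))
    (λ i j s≤i i< j< → bottom (suc i) (suc j) (s≤s s≤i) (s≤s i<) (s≤s j<))
  coefficient : ∀ x → + 1 *ᶻ x *ᶻ - (+ 1) ≡ - x
  coefficient = solve-∀

detℕ-single-bidiagonal : ∀ m a b E → b ≤ m → E 0 b ≈ a → (∀ j → j < suc m → j ≢ b → E 0 j ≈ 0P) →
  (∀ i j → i < m → j < m → E (suc i) (punchInℕ b j) ≈ bidiagonalRow (suc i) (punchInℕ b j)) →
  detℕ (suc m) E ≈ a ⊛ monoP (+ 1) (m ∸ b)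
detℕ-single-bidiagonal m a b E b≤m at off rows =
  ≈-trans (detℕ-row0-single m E b (s≤s b≤m) off)
  (≈-trans (scale-cong (sign b) (⊛-cong at minor-det))
  (≈-trans (scale-⊛-scale (sign b) a (sign b) P)
  (≈-trans (λ k → cong (_*ᶻ (a ⊛ P) k) (sign-sq b))
  (≈-trans (scale-one (a ⊛ P)) (⊛-congˡ a (X^-constP (m ∸ b) (+ 1)))))))
  where
  P = X^ (m ∸ b) · constP (+ 1)
  minor-det : detℕ m (minor 0 b E) ≈ scale (sign b) P
  minor-det = ≈-trans (detℕ-bidiagonal-block m b m (minor 0 b E) b≤m ℕ.≤-refl rows
      λ i j m≤i i<m _ → ⊥-elim (ℕ.<-irrefl refl (ℕ.<-≤-trans i<m m≤i)))
    (scale-cong (sign b) (X^-cong (m ∸ b) (≈-trans (detℕ-size (λ i j → minor 0 b E (m + i) (m + j)) (ℕ.n∸n≡0 m))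
                                                   (detℕ-empty _))))

single : Poly → ℕ → ℕ → Poly
single a b c = ifP (c ≡ᵇ b) a

single-at : ∀ a b → single a b b ≈ a
single-at a b k rewrite ≡ᵇ-refl b = refl

single-off : ∀ a {b c} → c ≢ b → single a b c ≈ 0P
single-off a c≢b k rewrite ≡ᵇ-false c≢b = refl

-- Indices start at 0, with n = suc N and d = suc e: withRows u v is x·I − C_n with its rows 0 and
-- suc e (the paper's rows 1 and d + 1) replaced by u and v.
module TwoRows (e M : ℕ) where

  N : ℕ
  N = suc (e + M)

  withRows : (ℕ → Poly) → (ℕ → Poly) → Matrix
  withRows u v r c = if r ≡ᵇ 0 then u c else if r ≡ᵇ suc e then v c else bidiagonalRow r c

  D : (ℕ → Poly) → (ℕ → Poly) → Poly
  D u v = detℕ (suc N) (withRows u v)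

  plainRowᵈ : ℕ → Poly
  plainRowᵈ = bidiagonalRow (suc e)

  e<N : e < N
  e<N = s≤s (ℕ.m≤m+n e M)

  withRows-dth : ∀ u v {r} c → r ≡ suc e → withRows u v r c ≈ v c
  withRows-dth u v c refl rewrite ≡ᵇ-refl e = ≈-refl

  withRows-other : ∀ u v {i} c → i ≢ e → withRows u v (suc i) c ≈ bidiagonalRow (suc i) c
  withRows-other u v c i≢e rewrite ≡ᵇ-false i≢e = ≈-refl

  withRows-plain : ∀ u i c → withRows u plainRowᵈ (suc i) c ≈ bidiagonalRow (suc i) c
  withRows-plain u i c with i ℕ.≟ e
  ... | yes refl = withRows-dth u plainRowᵈ c refl
  ... | no  i≢e  = withRows-other u plainRowᵈ c i≢e

  D-single-plain : ∀ a b → b ≤ N → D (single a b) plainRowᵈ ≈ a ⊛ monoP (+ 1) (N ∸ b)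
  D-single-plain a b b≤N = detℕ-single-bidiagonal N a b (withRows (single a b) plainRowᵈ) b≤N
    (single-at a b) (λ j _ j≢b → single-off a j≢b)
    (λ i j _ _ → withRows-plain (single a b) i (punchInℕ b j))

  D-x-plain : D (single X 0) plainRowᵈ ≈ monoP (+ 1) (suc N)
  D-x-plain = ≈-trans (D-single-plain X 0 z≤n) (≈-trans (X-⊛ (monoP (+ 1) N)) (X^-monoP 1 (+ 1) N))

  D-constant-plain : ∀ α b → b ≤ N → D (single (constP α) b) plainRowᵈ ≈ monoP α (N ∸ b)
  D-constant-plain α b b≤N = ≈-trans (D-single-plain (constP α) b b≤N)
    (≈-trans (constP-⊛-monoP α (+ 1) (N ∸ b)) (monoP-≡ {m = N ∸ b} (ℤ.*-identityʳ α) refl))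

  D-x-constant-low : ∀ β q → q ≤ e → D (single X 0) (single (constP β) q) ≈ 0P
  D-x-constant-low β q q≤e =
    ≈-trans (detℕ-row0-single N E 0 (s≤s z≤n) (λ j _ → single-off X))
      (scale-zeroʳ (+ 1) (⊛-zeroʳ X (detℕ-zero-topRight e N (minor 0 0 E) e<N zero-block)))
    where
    u = single X 0
    v = single (constP β) q
    E = withRows u v
    zero-block : ∀ i j → i ≤ e → e ≤ j → j < N → E (suc i) (suc j) ≈ 0P
    zero-block i j i≤e e≤j _ with i ℕ.≟ e
    ... | yes refl = ≈-trans (withRows-dth u v (suc j) refl)
                       (single-off (constP β) (ℕ.>⇒≢ (s≤s (ℕ.≤-trans q≤e e≤j))))
    ... | no  i≢e  = ≈-trans (withRows-other u v (suc j) i≢e)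
                       (bidiagonalRow-off (ℕ.<⇒≢ (s≤s i<j)) (ℕ.<⇒≢ (s≤s (ℕ.m<n⇒m<1+n i<j))))
      where
      i<j : i < j
      i<j = ℕ.<-≤-trans (ℕ.≤∧≢⇒< i≤e i≢e) e≤j

  D-x-constant-high : ∀ β b → b ≤ M →
    D (single X 0) (single (constP β) (suc (e + b))) ≈ monoP β (suc (e + (M ∸ b)))
  D-x-constant-high β b b≤M =
    ≈-trans (detℕ-row0-single N E 0 (s≤s z≤n) (λ j _ → single-off X))
    (≈-trans (scale-one (X ⊛ detℕ N E′))
    (≈-trans (⊛-congˡ X upper)
    (≈-trans (X-⊛ (X^ e · monoP β (M ∸ b))) (X^-monoP (suc e) β (M ∸ b)))))
    where
    q = suc (e + b)
    u = single X 0
    v = single (constP β) q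
    E = withRows u v
    E′ = minor 0 0 E
    L : Matrix
    L i j = E′ (e + i) (e + j)
    top : ∀ i j → i < e → j < N → E′ i j ≈ bidiagonalRow (suc i) (suc j)
    top i j i<e _ = withRows-other u v (suc j) (ℕ.<⇒≢ i<e)
    bottom : ∀ i j → e ≤ i → i < N → j < e → E′ i j ≈ 0P
    bottom i j e≤i _ j<e with i ℕ.≟ e
    ... | yes refl = ≈-trans (withRows-dth u v (suc j) refl)
                       (single-off (constP β) (ℕ.<⇒≢ (s≤s (ℕ.<-≤-trans j<e (ℕ.m≤m+n e b)))))
    ... | no  i≢e  = ≈-trans (withRows-other u v (suc j) i≢e)
                       (bidiagonalRow-off (ℕ.>⇒≢ (s≤s j<i)) (ℕ.>⇒≢ (s≤s (ℕ.≤-<-trans j<e e<i))))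
      where
      e<i : e < i
      e<i = ℕ.≤∧≢⇒< e≤i (i≢e ∘ sym)
      j<i : j < i
      j<i = ℕ.<-trans j<e e<i
    lower : detℕ (N ∸ e) L ≈ monoP β (M ∸ b)
    lower = ≈-trans (detℕ-size L (trans (cong (_∸ e) (sym (ℕ.+-suc e M))) (ℕ.m+n∸m≡n e (suc M))))
      (≈-trans (detℕ-single-bidiagonal M (constP β) b L b≤M
        (≈-trans (withRows-dth u v (suc (e + b)) (cong suc (ℕ.+-identityʳ e))) (single-at (constP β) q))
        (λ j _ j≢b → ≈-trans (withRows-dth u v (suc (e + j)) (cong suc (ℕ.+-identityʳ e)))
                       (single-off (constP β) (j≢b ∘ ℕ.+-cancelˡ-≡ e j b ∘ ℕ.suc-injective)))
        (λ i j _ _ → ≈-trans (withRows-other u v (suc (e + punchInℕ b j)) (ℕ.>⇒≢ (ℕ.m<m+n e (s≤s z≤n))))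
                       (≈-reflexive (bidiagonalRow-shift (suc e) (suc i) (punchInℕ b j)))))
      (≈-trans (constP-⊛-monoP β (+ 1) (M ∸ b)) (monoP-≡ {m = M ∸ b} (ℤ.*-identityʳ β) refl)))
    upper : detℕ N E′ ≈ X^ e · monoP β (M ∸ b)
    upper = ≈-trans (detℕ-bidiagonal-block e 0 N E′ z≤n (ℕ.<⇒≤ e<N) top bottom)
      (≈-trans (scale-one _) (X^-cong e lower))

  D-corner-constant-high : ∀ β b → b ≤ M →
    D (single (constP (- (+ 1))) N) (single (constP β) (suc (e + b))) ≈ 0P
  D-corner-constant-high β b b≤M =
    ≈-trans (detℕ-row0-single N E N (ℕ.n<1+n N) (λ j _ → single-off (constP (- (+ 1)))))
      (scale-zeroʳ (sign N) (⊛-zeroʳ (E 0 N) (detℕ-zero-bottomLeft e N (minor 0 N E) e<N zero-block)))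
    where
    q = suc (e + b)
    u = single (constP (- (+ 1))) N
    v = single (constP β) q
    E = withRows u v
    zero-block : ∀ i j → e ≤ i → i < N → j ≤ e → minor 0 N E i j ≈ 0P
    zero-block i j e≤i _ j≤e = ≈-trans (≈-reflexive (cong (withRows u v (suc i)) (punchInℕ-below j<N))) entry
      where
      j<N : j < N
      j<N = s≤s (ℕ.≤-trans j≤e (ℕ.m≤m+n e M))
      entry : E (suc i) j ≈ 0P
      entry with i ℕ.≟ e
      ... | yes refl = ≈-trans (withRows-dth u v j refl)
                         (single-off (constP β) (ℕ.<⇒≢ (s≤s (ℕ.≤-trans j≤e (ℕ.m≤m+n e b)))))
      ... | no  i≢e  = ≈-trans (withRows-other u v j i≢e)
                         (bidiagonalRow-off (ℕ.>⇒≢ (s≤s j≤i)) (j≢i ∘ sym ∘ ℕ.suc-injective))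
        where
        j≤i : j ≤ i
        j≤i = ℕ.≤-trans j≤e e≤i
        j≢i : j ≢ i
        j≢i j≡i = i≢e (ℕ.≤-antisym (ℕ.≤-trans (ℕ.≤-reflexive (sym j≡i)) j≤e) e≤i)

  -- x·I − C_n without its rows 0, suc e and its columns q, N
  cornerComplement : ℕ → Matrix
  cornerComplement q i j = bidiagonalRow (suc (punchInℕ e i)) (punchInℕ q j)

  det-cornerComplement : ∀ q → q ≤ e → detℕ (e + M) (cornerComplement q) ≈ monoP (sign q *ᶻ sign M) (e ∸ q)
  det-cornerComplement q q≤e =
    ≈-trans (detℕ-bidiagonal-block e q (e + M) (cornerComplement q) q≤e (ℕ.m≤m+n e M) top bottom)
    (≈-trans (scale-cong (sign q) (≈-trans (X^-cong (e ∸ q) lower) (X^-scale (e ∸ q) (sign M) (constP (+ 1)))))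
    (≈-trans (scale-cong (sign q) (scale-cong (sign M) (X^-constP (e ∸ q) (+ 1))))
    (≈-trans (scale-cong (sign q) (scale-monoP (sign M) (+ 1) (e ∸ q)))
    (≈-trans (scale-monoP (sign q) (sign M *ᶻ + 1) (e ∸ q))
             (monoP-≡ {m = e ∸ q} (cong (sign q *ᶻ_) (ℤ.*-identityʳ (sign M))) refl)))))
    where
    B = cornerComplement q
    top : ∀ i j → i < e → j < e + M → B i j ≈ bidiagonalRow (suc i) (punchInℕ q j)
    top i j i<e _ = ≈-reflexive (cong (λ r → bidiagonalRow (suc r) (punchInℕ q j)) (punchInℕ-below i<e))
    bottom : ∀ i j → e ≤ i → i < e + M → j < e → B i j ≈ 0P
    bottom i j e≤i _ j<e =
      ≈-trans (≈-reflexive (cong (λ r → bidiagonalRow (suc r) (punchInℕ q j)) (punchInℕ-above e≤i)))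
        (bidiagonalRow-off (ℕ.>⇒≢ (s≤s (ℕ.m≤n⇒m≤1+n pj≤i))) (ℕ.>⇒≢ (s≤s (s≤s pj≤i))))
      where
      pj≤i : punchInℕ q j ≤ i
      pj≤i = ℕ.≤-trans (punchInℕ≤suc q j) (ℕ.≤-trans j<e e≤i)
    L : Matrix
    L i j = B (e + i) (e + j)
    lower-entry : ∀ i j → i < M → j < M → L i j ≈ bidiagonalRow (suc i) (punchInℕ M j)
    lower-entry i j _ j<M = ≈-reflexive
      (trans (cong₂ (λ r c → bidiagonalRow (suc r) c) (punchInℕ-above (ℕ.m≤m+n e i))
                                                     (punchInℕ-above (ℕ.≤-trans q≤e (ℕ.m≤m+n e j))))
      (trans (cong (λ r → bidiagonalRow (suc r) (suc (e + j))) (sym (ℕ.+-suc e i)))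
      (trans (bidiagonalRow-shift (suc e) (suc i) j)
             (cong (bidiagonalRow (suc i)) (sym (punchInℕ-below j<M))))))
    lower : detℕ (e + M ∸ e) L ≈ scale (sign M) (constP (+ 1))
    lower = ≈-trans (detℕ-size L (ℕ.m+n∸m≡n e M))
      (≈-trans (detℕ-bidiagonal-block M M M L ℕ.≤-refl ℕ.≤-refl lower-entry
                 λ i j M≤i i<M _ → ⊥-elim (ℕ.<-irrefl refl (ℕ.<-≤-trans i<M M≤i)))
      (scale-cong (sign M) (≈-trans (X^-cong (M ∸ M) (≈-trans (detℕ-size (λ i j → L (M + i) (M + j)) (ℕ.n∸n≡0 M))
                                                              (detℕ-empty _)))
                                    (≈-reflexive (cong (λ a → X^ a · constP (+ 1)) (ℕ.n∸n≡0 M))))))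

  D-corner-constant-low : ∀ β q → q ≤ e →
    D (single (constP (- (+ 1))) N) (single (constP β) q) ≈ monoP β (e ∸ q)
  D-corner-constant-low β q q≤e = begin
    D u v
      ≈⟨ detℕ-row0-single N E N (ℕ.n<1+n N) (λ j _ → single-off (constP (- (+ 1)))) ⟩
    scale (sign N) (E 0 N ⊛ detℕ N E′)
      ≈⟨ scale-cong (sign N) (⊛-cong (single-at (constP (- (+ 1))) N) corner-minor) ⟩
    scale (sign N) (constP (- (+ 1)) ⊛ monoP K (e ∸ q))
      ≈⟨ scale-cong (sign N) (constP-⊛-monoP (- (+ 1)) K (e ∸ q)) ⟩
    scale (sign N) (monoP (- (+ 1) *ᶻ K) (e ∸ q))
      ≈⟨ scale-monoP (sign N) (- (+ 1) *ᶻ K) (e ∸ q) ⟩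
    monoP (sign N *ᶻ (- (+ 1) *ᶻ K)) (e ∸ q)
      ≈⟨ monoP-≡ {m = e ∸ q} coefficient refl ⟩
    monoP β (e ∸ q) ∎
    where
    open ≈-Reasoning
    u = single (constP (- (+ 1))) N
    v = single (constP β) q
    E = withRows u v
    E′ = minor 0 N E
    K = β *ᶻ sign (e + q) *ᶻ (sign q *ᶻ sign M)
    q<N : q < N
    q<N = s≤s (ℕ.≤-trans q≤e (ℕ.m≤m+n e M))
    row-d : ∀ j → j < N → E′ e j ≈ single (constP β) q j
    row-d j j<N = ≈-trans (≈-reflexive (cong (E (suc e)) (punchInℕ-below j<N))) (withRows-dth u v j refl)
    corner-minor : detℕ N E′ ≈ monoP K (e ∸ q)
    corner-minor =
      ≈-trans (detℕ-row-single (e + M) e q β E′ e<N q<N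
                 (≈-trans (row-d q q<N) (single-at (constP β) q))
                 (λ j j<N j≢q → ≈-trans (row-d j j<N) (single-off (constP β) j≢q)))
      (≈-trans (scale-cong (β *ᶻ sign (e + q)) (≈-trans (detℕ-cong (e + M) λ i j _ j< →
                 ≈-trans (≈-reflexive (cong (E (suc (punchInℕ e i))) (punchInℕ-below (punchInℕ-bound q j<))))
                         (withRows-other u v (punchInℕ q j) (punchInℕᵢ≢i e i)))
               (det-cornerComplement q q≤e)))
      (scale-monoP (β *ᶻ sign (e + q)) (sign q *ᶻ sign M) (e ∸ q)))
    coefficient : sign N *ᶻ (- (+ 1) *ᶻ K) ≡ β
    coefficient =
      trans (cong₂ (λ a b → - a *ᶻ (- (+ 1) *ᶻ (β *ᶻ b *ᶻ (sign q *ᶻ sign M)))) (sign-+ e M) (sign-+ e q))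
      (trans (regroup (sign e) (sign q) (sign M) β)
        (trans (cong (β *ᶻ_) (cong₂ _*ᶻ_ (sign-sq e) (cong₂ _*ᶻ_ (sign-sq q) (sign-sq M)))) (ℤ.*-identityʳ β)))
      where
      regroup : ∀ a b c x → - (a *ᶻ c) *ᶻ (- (+ 1) *ᶻ (x *ᶻ (a *ᶻ b) *ᶻ (b *ᶻ c)))
                          ≡ x *ᶻ ((a *ᶻ a) *ᶻ ((b *ᶻ b) *ᶻ (c *ᶻ c)))
      regroup = solve-∀

  D-single-sameColumn : ∀ a b p → p ≤ N → D (single a p) (single b p) ≈ 0P
  D-single-sameColumn a b p p≤N =
    ≈-trans (detℕ-row0-single N E p (s≤s p≤N) (λ j _ → single-off a))
      (scale-zeroʳ (sign p) (⊛-zeroʳ (E 0 p) (detℕ-zero-row N e (minor 0 p E) e<N λ j _ →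
        ≈-trans (withRows-dth u v (punchInℕ p j) refl) (single-off b (punchInℕᵢ≢i p j)))))
    where
    u = single a p
    v = single b p
    E = withRows u v

  -- det of x·I − C_n without its rows 0, suc e and its columns p, q
  doubleMinor : ℕ → ℕ → Poly
  doubleMinor p q = detℕ (e + M) λ i j →
    bidiagonalRow (suc (punchInℕ e i)) (punchInℕ p (punchInℕ (punchOutℕ p q) j))

  doubleMinor-sym : ∀ {p q} → q ≢ p → doubleMinor q p ≈ doubleMinor p q
  doubleMinor-sym {p} {q} q≢p = detℕ-cong (e + M) λ i j _ _ →
    ≈-reflexive (cong (bidiagonalRow (suc (punchInℕ e i))) (sym
      (subst (λ z → punchInℕ z (punchInℕ (punchOutℕ z q) j) ≡ punchInℕ q (punchInℕ (punchOutℕ q p) j))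
             (punchInℕ-punchOutℕ (q≢p ∘ sym)) (punchInℕ-swap q (punchOutℕ q p) j))))

  D-constant-constant : ∀ α β p q → q ≢ p → p ≤ N → q ≤ N →
    D (single (constP α) p) (single (constP β) q)
      ≈ scale (sign p *ᶻ (β *ᶻ sign (e + punchOutℕ p q)) *ᶻ α) (doubleMinor p q)
  D-constant-constant α β p q q≢p p≤N q≤N =
    ≈-trans (detℕ-row0-single N E p (s≤s p≤N) (λ j _ → single-off (constP α)))
    (≈-trans (scale-cong (sign p) (⊛-cong (single-at (constP α) p) minor-det))
    (≈-trans (scale-⊛-scale (sign p) (constP α) K (doubleMinor p q))
    (≈-trans (scale-cong (sign p *ᶻ K) (constP-⊛ α (doubleMinor p q)))
             (scale-scale (sign p *ᶻ K) α (doubleMinor p q)))))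
    where
    u = single (constP α) p
    v = single (constP β) q
    E = withRows u v
    t = punchOutℕ p q
    K = β *ᶻ sign (e + t)
    minor-det : detℕ N (minor 0 p E) ≈ scale K (doubleMinor p q)
    minor-det = ≈-trans
      (detℕ-row-single (e + M) e t β (minor 0 p E) e<N (punchOutℕ-bound q≢p (s≤s q≤N) (s≤s p≤N))
        (≈-trans (withRows-dth u v (punchInℕ p t) refl)
          (≈-trans (≈-reflexive (cong (single (constP β) q) (punchInℕ-punchOutℕ q≢p))) (single-at (constP β) q)))
        (λ j _ j≢t → ≈-trans (withRows-dth u v (punchInℕ p j) refl) (single-off (constP β) λ pj≡q →
          j≢t (punchInℕ-injective p j t (trans pj≡q (sym (punchInℕ-punchOutℕ q≢p)))))))
      (scale-cong K (detℕ-cong (e + M) λ i j _ _ →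
        withRows-other u v (punchInℕ p (punchInℕ t j)) (punchInℕᵢ≢i e i)))

  D-constant-constant-swap : ∀ α β α′ β′ p q → q ≢ p → p ≤ N → q ≤ N → α *ᶻ β ≡ α′ *ᶻ β′ →
    D (single (constP α) p) (single (constP β) q) ⊕ D (single (constP α′) q) (single (constP β′) p) ≈ 0P
  D-constant-constant-swap α β α′ β′ p q q≢p p≤N q≤N αβ≡α′β′ k =
    trans (cong₂ _+ᶻ_ (D-constant-constant α β p q q≢p p≤N q≤N k)
            (trans (D-constant-constant α′ β′ q p (q≢p ∘ sym) q≤N p≤N k)
                   (cong (K′ *ᶻ_) (doubleMinor-sym q≢p k))))
      (trans (sym (ℤ.*-distribʳ-+ (doubleMinor p q k) K K′))
             (cong (_*ᶻ doubleMinor p q k) coefficients-cancel))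
    where
    t  = punchOutℕ p q
    t′ = punchOutℕ q p
    K  = sign p *ᶻ (β *ᶻ sign (e + t)) *ᶻ α
    K′ = sign q *ᶻ (β′ *ᶻ sign (e + t′)) *ᶻ α′
    signs : sign p *ᶻ sign t ≡ - (sign q *ᶻ sign t′)
    signs = subst (λ z → sign z *ᶻ sign (punchOutℕ z q) ≡ - (sign q *ᶻ sign t′))
                  (punchInℕ-punchOutℕ (q≢p ∘ sym)) (sign-punchInℕ-swap q t′)
    coefficients-cancel : K +ᶻ K′ ≡ + 0
    coefficients-cancel =
      trans (cong₂ (λ x y → sign p *ᶻ (β *ᶻ x) *ᶻ α +ᶻ sign q *ᶻ (β′ *ᶻ y) *ᶻ α′) (sign-+ e t) (sign-+ e t′))
      (trans (regroup (sign p) (sign t) (sign q) (sign t′) (sign e) α β α′ β′)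
      (trans (cong₂ (λ x y → sign e *ᶻ x *ᶻ y +ᶻ sign e *ᶻ (α′ *ᶻ β′) *ᶻ (sign q *ᶻ sign t′)) αβ≡α′β′ signs)
             (opposite (sign e *ᶻ (α′ *ᶻ β′)) (sign q *ᶻ sign t′))))
      where
      regroup : ∀ sp st sq st′ se a b a′ b′ →
        sp *ᶻ (b *ᶻ (se *ᶻ st)) *ᶻ a +ᶻ sq *ᶻ (b′ *ᶻ (se *ᶻ st′)) *ᶻ a′
          ≡ se *ᶻ (a *ᶻ b) *ᶻ (sp *ᶻ st) +ᶻ se *ᶻ (a′ *ᶻ b′) *ᶻ (sq *ᶻ st′)
      regroup = solve-∀
      opposite : ∀ x y → x *ᶻ (- y) +ᶻ x *ᶻ y ≡ + 0
      opposite = solve-∀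

  D-additive-first : ∀ u₁ u₂ v → D (λ c → u₁ c ⊕ u₂ c) v ≈ D u₁ v ⊕ D u₂ v
  D-additive-first u₁ u₂ v =
    detℕ-linear-row (suc N) 0 (withRows (λ c → u₁ c ⊕ u₂ c) v) (withRows u₁ v) (withRows u₂ v)
    (s≤s z≤n) (λ _ _ → ≈-refl) below below
    where
    below : ∀ {w} i j → i < suc N → j < suc N → i ≢ 0 → withRows (λ c → u₁ c ⊕ u₂ c) v i j ≈ withRows w v i j
    below zero    _ _ _ 0≢0 = ⊥-elim (0≢0 refl)
    below (suc i) _ _ _ _   = ≈-refl

  D-additive-dth : ∀ u v₁ v₂ → D u (λ c → v₁ c ⊕ v₂ c) ≈ D u v₁ ⊕ D u v₂
  D-additive-dth u v₁ v₂ = detℕ-linear-row (suc N) (suc e) (withRows u v) (withRows u v₁) (withRows u v₂) (s≤s e<N)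
    (λ j _ → ≈-trans (withRows-dth u v j refl)
                     (⊕-cong (≈-sym (withRows-dth u v₁ j refl)) (≈-sym (withRows-dth u v₂ j refl))))
    other other
    where
    v = λ c → v₁ c ⊕ v₂ c
    other : ∀ {w} i j → i < suc N → j < suc N → i ≢ suc e → withRows u v i j ≈ withRows u w i j
    other zero    _ _ _ _     = ≈-refl
    other {w} (suc i) j _ _ i≢d =
      ≈-trans (withRows-other u v j (i≢d ∘ cong suc)) (≈-sym (withRows-other u w j (i≢d ∘ cong suc)))


  D-x-corner-constant : ∀ β q → q ≤ N →
    D (single X 0) (single (constP β) q) ⊕ D (single (constP (- (+ 1))) N) (single (constP β) q)
      ≈ monoP β ((suc N ∸ suc q + suc e) % suc N)
  D-x-corner-constant β q q≤N with suc e ℕ.≤? q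
  ... | no q≰e =
    ≈-trans (⊕-identityˡ (D-x-constant-low β q q≤e))
      (≈-trans (D-corner-constant-low β q q≤e) (monoP-≡ refl (sym wraps-around)))
    where
    q≤e : q ≤ e
    q≤e = ℕ.≤-pred (ℕ.≰⇒> q≰e)
    wraps-around : (N ∸ q + suc e) % suc N ≡ e ∸ q
    wraps-around = trans (cong (_% suc N) (ℕ.+-cancelʳ-≡ q _ _ (trans
        (trans (shuffle (N ∸ q) (suc e) q) (cong (_+ suc e) (ℕ.m∸n+n≡m q≤N)))
        (sym (trans (shuffle (e ∸ q) (suc N) q) (trans (cong (_+ suc N) (ℕ.m∸n+n≡m q≤e)) (swap-suc e N)))))))
      (trans ([m+n]%n≡m%n (e ∸ q) (suc N)) (m<n⇒m%n≡m (s≤s (ℕ.≤-trans (ℕ.m∸n≤m e q) (ℕ.<⇒≤ e<N)))))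
      where
      shuffle : ∀ a b c → a + b + c ≡ a + c + b
      shuffle = ℕ-Solver.solve-∀
      swap-suc : ∀ a b → a + suc b ≡ b + suc a
      swap-suc = ℕ-Solver.solve-∀
  ... | yes e<q with ℕ.m≤n⇒∃[o]m+o≡n e<q
  ...   | b , refl =
    ≈-trans (⊕-identityʳ (D-corner-constant-high β b b≤M))
      (≈-trans (D-x-constant-high β b b≤M) (monoP-≡ refl (sym no-wrap)))
    where
    b≤M : b ≤ M
    b≤M = ℕ.+-cancelˡ-≤ e b M (ℕ.≤-pred q≤N)
    no-wrap : (e + M ∸ (e + b) + suc e) % suc N ≡ suc (e + (M ∸ b))
    no-wrap = trans (cong (λ t → (t + suc e) % suc N) (ℕ.[m+n]∸[m+o]≡n∸o e M b))
      (trans (cong (_% suc N) (trans (ℕ.+-suc (M ∸ b) e) (cong suc (ℕ.+-comm (M ∸ b) e))))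
      (m<n⇒m%n≡m (s≤s (s≤s (ℕ.+-monoʳ-≤ e (ℕ.m∸n≤m M b))))))

  module _ (b₁ b₂ : ℕ) where

    x₀ corner u₁ u₂ v₁ v₂ : ℕ → Poly
    x₀     = single X 0
    corner = single (constP (- (+ 1))) N
    u₁     = single (constP (- (+ 1))) b₁
    u₂     = single (constP (+ 1)) b₂
    v₁     = single (constP (+ 1)) b₁
    v₂     = single (constP (- (+ 1))) b₂

    firstRow : ℕ → Poly
    firstRow c = x₀ c ⊕ (corner c ⊕ (u₁ c ⊕ u₂ c))

    dthRow : ℕ → Poly
    dthRow c = plainRowᵈ c ⊕ (v₁ c ⊕ v₂ c)

    -- entry (r, c) of the matrix whose determinant is
    -- charPoly (C n ⊞ T n 1 (suc b₁) (suc (suc e)) (suc b₂)), in ℕ coordinates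
    charEntry : ℕ → ℕ → Poly
    charEntry r c = (if r ≡ᵇ c then X else constP (+ 0)) ⊕ constP (- (
        ind ((r ≡ᵇ suc c) ∨ ((r ≡ᵇ 0) ∧ (suc c ≡ᵇ suc N)))
      +ᶻ ((ind ((suc r ≡ᵇ 1) ∧ (suc c ≡ᵇ suc b₁)) +ᶻ ind ((suc r ≡ᵇ suc (suc e)) ∧ (suc c ≡ᵇ suc b₂)))
         -ᶻ (ind ((suc r ≡ᵇ 1) ∧ (suc c ≡ᵇ suc b₂)) +ᶻ ind ((suc r ≡ᵇ suc (suc e)) ∧ (suc c ≡ᵇ suc b₁))))))

    entry : ∀ r c → charEntry r c ≈ withRows firstRow dthRow r c
    entry zero c = ⊕-cong (diagonal c)
      (≈-trans (≈-reflexive (cong constP (regroup (ind (c ≡ᵇ N)) (ind (c ≡ᵇ b₁)) (ind (c ≡ᵇ b₂)))))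
               (constP-*-ind₃ (- (+ 1)) (- (+ 1)) (+ 1) (c ≡ᵇ N) (c ≡ᵇ b₁) (c ≡ᵇ b₂)))
      where
      diagonal : ∀ c → (if 0 ≡ᵇ c then X else constP (+ 0)) ≈ single X 0 c
      diagonal zero    = ≈-refl
      diagonal (suc c) = constP-zero
      regroup : ∀ x y z → - (x +ᶻ ((y +ᶻ + 0) -ᶻ (z +ᶻ + 0))) ≡ - (+ 1) *ᶻ x +ᶻ (- (+ 1) *ᶻ y +ᶻ + 1 *ᶻ z)
      regroup = solve-∀
    entry (suc r) c with r ℕ.≟ e
    ... | yes refl rewrite ≡ᵇ-refl r | ∨-identityʳ (r ≡ᵇ c) =
      ≈-trans (⊕-cong (if-constP-zero (suc r ≡ᵇ c) X)
                (≈-trans (≈-reflexive (cong constP (regroup (ind (r ≡ᵇ c)) (ind (c ≡ᵇ b₁)) (ind (c ≡ᵇ b₂)))))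
                         (constP-*-ind₃ (- (+ 1)) (+ 1) (- (+ 1)) (r ≡ᵇ c) (c ≡ᵇ b₁) (c ≡ᵇ b₂))))
        (≈-sym (⊕-assoc (ifP (suc r ≡ᵇ c) X) (ifP (r ≡ᵇ c) (constP (- (+ 1)))) _))
      where
      regroup : ∀ x y z → - (x +ᶻ ((+ 0 +ᶻ z) -ᶻ (+ 0 +ᶻ y))) ≡ - (+ 1) *ᶻ x +ᶻ (+ 1 *ᶻ y +ᶻ - (+ 1) *ᶻ z)
      regroup = solve-∀
    ... | no r≢e rewrite ≡ᵇ-false r≢e | ∨-identityʳ (r ≡ᵇ c) =
      ⊕-cong (if-constP-zero (suc r ≡ᵇ c) X)
        (≈-trans (≈-reflexive (cong constP (regroup (ind (r ≡ᵇ c))))) (constP-*-ind (- (+ 1)) (r ≡ᵇ c)))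
      where
      regroup : ∀ x → - (x +ᶻ ((+ 0 +ᶻ + 0) -ᶻ (+ 0 +ᶻ + 0))) ≡ - (+ 1) *ᶻ x
      regroup = solve-∀

    charPoly≈D : charPoly (C (suc N) ⊞ T (suc N) 1 (suc b₁) (suc (suc e)) (suc b₂)) ≈ D firstRow dthRow
    charPoly≈D = ≈-trans
      (det-cong {suc N} (λ i j → charEntry (toℕ i) (toℕ j)) (λ i j → withRows firstRow dthRow (toℕ i) (toℕ j))
        λ i j → entry (toℕ i) (toℕ j))
      (det≈detℕ (withRows firstRow dthRow))

    D-firstRow : ∀ w → D firstRow w ≈ D x₀ w ⊕ (D corner w ⊕ (D u₁ w ⊕ D u₂ w))
    D-firstRow w = ≈-trans (D-additive-first x₀ (λ c → corner c ⊕ (u₁ c ⊕ u₂ c)) w)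
      (⊕-cong (≈-refl {D x₀ w}) (≈-trans (D-additive-first corner (λ c → u₁ c ⊕ u₂ c) w)
        (⊕-cong (≈-refl {D corner w}) (D-additive-first u₁ u₂ w))))

    D-dthRow : D firstRow dthRow ≈ D firstRow plainRowᵈ ⊕ (D firstRow v₁ ⊕ D firstRow v₂)
    D-dthRow = ≈-trans (D-additive-dth firstRow plainRowᵈ (λ c → v₁ c ⊕ v₂ c))
      (⊕-cong (≈-refl {D firstRow plainRowᵈ}) (D-additive-dth firstRow v₁ v₂))

    D-firstRow-dthRow : b₁ ≤ N → b₂ ≤ N → b₁ ≢ b₂ → D firstRow dthRow ≈
      (((((monoP (+ 1) (suc N) ⊕ monoP (- (+ 1)) (N ∸ b₁)) ⊕ monoP (+ 1) ((N ∸ b₁ + suc e) % suc N))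
        ⊕ monoP (+ 1) (N ∸ b₂)) ⊕ monoP (- (+ 1)) ((N ∸ b₂ + suc e) % suc N)) ⊕ monoP (- (+ 1)) 0)
    D-firstRow-dthRow b₁≤N b₂≤N b₁≢b₂ k =
      trans (D-dthRow k)
      (trans (cong₂ _+ᶻ_ (D-firstRow plainRowᵈ k) (cong₂ _+ᶻ_ (D-firstRow v₁ k) (D-firstRow v₂ k)))
      (trans (rearrange (D x₀ plainRowᵈ k) (D corner plainRowᵈ k) (D u₁ plainRowᵈ k) (D u₂ plainRowᵈ k)
                        (D x₀ v₁ k) (D corner v₁ k) (D u₁ v₁ k) (D u₂ v₁ k)
                        (D x₀ v₂ k) (D corner v₂ k) (D u₁ v₂ k) (D u₂ v₂ k))
      (trans (cong₂ _+ᶻ_ (surviving k) (vanishing k)) (ℤ.+-identityʳ _))))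
      where
      rearrange : ∀ a₀ aₙ a₁ a₂ y₁ n₁ w₁₁ w₂₁ y₂ n₂ w₁₂ w₂₂ →
        (a₀ +ᶻ (aₙ +ᶻ (a₁ +ᶻ a₂))) +ᶻ ((y₁ +ᶻ (n₁ +ᶻ (w₁₁ +ᶻ w₂₁))) +ᶻ (y₂ +ᶻ (n₂ +ᶻ (w₁₂ +ᶻ w₂₂))))
          ≡ (((((a₀ +ᶻ a₁) +ᶻ (y₁ +ᶻ n₁)) +ᶻ a₂) +ᶻ (y₂ +ᶻ n₂)) +ᶻ aₙ) +ᶻ ((w₁₁ +ᶻ w₂₂) +ᶻ (w₁₂ +ᶻ w₂₁))
      rearrange = solve-∀
      surviving : (((((D x₀ plainRowᵈ ⊕ D u₁ plainRowᵈ) ⊕ (D x₀ v₁ ⊕ D corner v₁)) ⊕ D u₂ plainRowᵈ)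
                    ⊕ (D x₀ v₂ ⊕ D corner v₂)) ⊕ D corner plainRowᵈ)
        ≈ (((((monoP (+ 1) (suc N) ⊕ monoP (- (+ 1)) (N ∸ b₁)) ⊕ monoP (+ 1) ((N ∸ b₁ + suc e) % suc N))
            ⊕ monoP (+ 1) (N ∸ b₂)) ⊕ monoP (- (+ 1)) ((N ∸ b₂ + suc e) % suc N)) ⊕ monoP (- (+ 1)) 0)
      surviving =
        ⊕-cong (⊕-cong (⊕-cong (⊕-cong (⊕-cong D-x-plain (D-constant-plain (- (+ 1)) b₁ b₁≤N))
                                        (D-x-corner-constant (+ 1) b₁ b₁≤N))
                                (D-constant-plain (+ 1) b₂ b₂≤N))
                        (D-x-corner-constant (- (+ 1)) b₂ b₂≤N))
               (≈-trans (D-constant-plain (- (+ 1)) N ℕ.≤-refl) (monoP-≡ refl (ℕ.n∸n≡0 N)))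
      vanishing : (D u₁ v₁ ⊕ D u₂ v₂) ⊕ (D u₁ v₂ ⊕ D u₂ v₁) ≈ 0P
      vanishing = ≈-trans
        (⊕-identityˡ {q = D u₁ v₂ ⊕ D u₂ v₁}
          (≈-trans (⊕-identityˡ {q = D u₂ v₂} (D-single-sameColumn (constP (- (+ 1))) (constP (+ 1)) b₁ b₁≤N))
                   (D-single-sameColumn (constP (+ 1)) (constP (- (+ 1))) b₂ b₂≤N)))
        (D-constant-constant-swap (- (+ 1)) (- (+ 1)) (+ 1) (+ 1) b₁ b₂ (b₁≢b₂ ∘ sym) b₁≤N b₂≤N refl)

  charPoly-perturbed : ∀ n .{{_ : NonZero n}} → n ≡ suc N → ∀ b₁ b₂ i₂ → i₂ ≡ suc (suc e) →
    suc b₁ ≤ n → suc b₂ ≤ n → suc b₁ ≢ suc b₂ →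
    ∀ k → charPoly (C n ⊞ T n 1 (suc b₁) i₂ (suc b₂)) k
        ≡ ((((( monoP (+ 1) n
             ⊕ monoP (- (+ 1)) (n ∸ suc b₁))
             ⊕ monoP (+ 1) (rem n (n ∸ suc b₁ + suc e)))
             ⊕ monoP (+ 1) (n ∸ suc b₂))
             ⊕ monoP (- (+ 1)) (rem n (n ∸ suc b₂ + suc e)))
             ⊕ monoP (- (+ 1)) 0) k
  charPoly-perturbed .(suc N) refl b₁ b₂ .(suc (suc e)) refl (s≤s b₁≤N) (s≤s b₂≤N) j₁≢j₂ k =
    trans (charPoly≈D b₁ b₂ k) (D-firstRow-dthRow b₁ b₂ b₁≤N b₂≤N (j₁≢j₂ ∘ cong suc) k)

theorem4p3 : (n d j₁ j₂ : ℕ) → .{{_ : NonZero n}} → 2 ≤ n → 1 ≤ d → 2 * d ≤ n →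
    1 ≤ j₁ → j₁ ≤ n → 1 ≤ j₂ → j₂ ≤ n → j₁ ≢ j₂ →
    ∀ k → charPoly (C n ⊞ T n 1 j₁ (d + 1) j₂) k
        ≡ ((((( monoP (+ 1) n
             ⊕ monoP (- (+ 1)) (n ∸ j₁))
             ⊕ monoP (+ 1) (rem n (n ∸ j₁ + d)))
             ⊕ monoP (+ 1) (n ∸ j₂))
             ⊕ monoP (- (+ 1)) (rem n (n ∸ j₂ + d)))
             ⊕ monoP (- (+ 1)) 0) k
theorem4p3 n (suc e) (suc b₁) (suc b₂) _ (s≤s z≤n) 2d≤n (s≤s z≤n) j₁≤n (s≤s z≤n) j₂≤n j₁≢j₂ =
  let (extra , 2d+extra≡n) = ℕ.m≤n⇒∃[o]m+o≡n 2d≤n in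
  TwoRows.charPoly-perturbed e (e + extra) n (trans (sym 2d+extra≡n) (size e extra))
    b₁ b₂ (suc e + 1) (ℕ.+-comm (suc e) 1) j₁≤n j₂≤n j₁≢j₂
  where
  size : ∀ e extra → 2 * suc e + extra ≡ suc (suc (e + (e + extra)))
  size = ℕ-Solver.solve-∀
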